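{- For all $m\geq 3$ and $n\geq 4$, the graph $P_m\Box C_n$ is $2$-spanning cyclable.
   Context: $P_m$ is the path of order $m$, $C_n$ the cycle of order $n$, $\Box$ the Cartesian product. A 2-factor of a graph is a spanning subgraph in which every vertex has valency 2. A 2-factor separates a set $A$ of $k$ vertices if it consists of exactly $k$ cycles and $A$ meets the vertex set of each cycle in exactly one vertex. A graph $X$ is $k$-spanning cyclable if for every $A\subseteq V(X)$ with $|A|=k$ there is a 2-factor of $X$ separating $A$. -}

module Defs where

open import Data.Nat using (ℕ; suc; _+_; _≤_)
open import Data.Fin using (Fin; toℕ)
open import Data.List using (List; []; _∷_; _++_; [_]; length; concat)
open import Data.List.Membership.Propositional using (_∈_)
open import Data.List.Relation.Unary.All using (All)
open import Data.List.Relation.Unary.Unique.Propositional using (Unique)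
open import Data.Product using (Σ; _×_; ∃; _,_)
open import Data.Sum using (_⊎_)
open import Data.Unit using (⊤)
open import Data.Empty using (⊥)
open import Relation.Binary.PropositionalEquality using (_≡_)

PathAdj : (m : ℕ) → Fin m → Fin m → Set
PathAdj m i j = (suc (toℕ i) ≡ toℕ j) ⊎ (suc (toℕ j) ≡ toℕ i)

CycleAdj : (n : ℕ) → Fin n → Fin n → Set
CycleAdj n j j' =
  (suc (toℕ j) ≡ toℕ j') ⊎ (suc (toℕ j') ≡ toℕ j)
  ⊎ (suc (toℕ j) ≡ n × toℕ j' ≡ 0) ⊎ (suc (toℕ j') ≡ n × toℕ j ≡ 0)

Box : {V W : Set} → (V → V → Set) → (W → W → Set) → (V × W → V × W → Set)
Box G H (u , v) (u' , v') = (u ≡ u' × H v v') ⊎ (G u u' × v ≡ v')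

PmCn : (m n : ℕ) → Fin m × Fin n → Fin m × Fin n → Set
PmCn m n = Box (PathAdj m) (CycleAdj n)

Walk : {V : Set} → (V → V → Set) → List V → Set
Walk E [] = ⊤
Walk E (x ∷ []) = ⊤
Walk E (x ∷ y ∷ r) = E x y × Walk E (y ∷ r)

ClosedWalk : {V : Set} → (V → V → Set) → List V → Set
ClosedWalk E [] = ⊥
ClosedWalk E (x ∷ xs) = Walk E ((x ∷ xs) ++ [ x ])

IsCycle : {V : Set} → (V → V → Set) → List V → Set
IsCycle E c = 3 ≤ length c × Unique c × ClosedWalk E c

-- A 2-factor, given as its list of cycles: vertex-disjoint cycles of the
-- graph covering every vertex (a spanning 2-regular subgraph).
TwoFactor : {V : Set} → (V → V → Set) → List (List V) → Set
TwoFactor {V} E cs =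
  All (IsCycle E) cs × Unique (concat cs) × ((v : V) → v ∈ concat cs)

MeetsOnce : {V : Set} → List V → List V → Set
MeetsOnce {V} A c =
  Σ V (λ a → a ∈ A × a ∈ c × ((b : V) → b ∈ A → b ∈ c → b ≡ a))

Separates : {V : Set} → (V → V → Set) → ℕ → List V → List (List V) → Set
Separates E k A cs = TwoFactor E cs × length cs ≡ k × All (MeetsOnce A) cs

SpanningCyclable : (V : Set) → (V → V → Set) → ℕ → Set
SpanningCyclable V E k =
  (A : List V) → Unique A → length A ≡ k →
  ∃ (λ (cs : List (List V)) → Separates E k A cs)

{-# OPTIONS --safe #-}

-- Cells are pairs (row , column), column 0 being where the cycle C_n closes up.  Two cells in
-- different rows r₁ < r₂ are separated by cutting the grid between the rows r₂ - 1 and r₂: each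
-- band of consecutive rows has a Hamiltonian cycle, a boustrophedon through the columns 1 … n - 1
-- closed up along column 0.  For two cells in the same row r, rotating the columns reduces to
-- separating (r , n - 1) from (r , c) with c < n - 2.  These are separated by the 4-cycle on the
-- columns n - 2, n - 1 of two consecutive rows s, s + 1 containing r, together with a Hamiltonian
-- cycle of its complement: boustrophedons of the rows above, of the rows s, s + 1 within the
-- columns 1 … n - 3, and of the rows below, joined up through column 0.
-- The cycles are built in ℕ × ℕ and then mapped to Fin m × Fin n; instead of checking that they
-- repeat no cell, it suffices that they cover the grid with total length m n.

module Submission where

open import Defs
open import Data.Bool using (Bool; true; false; not)
open import Data.Bool.Properties using (not-involutive)
open import Data.Nat using (ℕ; zero; suc; _+_; _*_; _≤_; _<_; z≤n; s≤s; NonZero)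
open import Data.Nat.Properties
open import Data.Nat.DivMod using (_%_; _mod_; m<n⇒m%n≡m; n%n≡0; m%n<n)
open import Data.Nat.Tactic.RingSolver using (solve-∀)
open import Data.Fin using (Fin; toℕ)
open import Data.Fin.Properties using (toℕ-fromℕ<; toℕ-injective; toℕ<n)
open import Data.List
  using (List; []; _∷_; _++_; [_]; length; map; applyUpTo; applyDownFrom; cartesianProduct; allFin)
open import Data.List.Properties
  using ( length-++; length-map; length-++-sucʳ; ++-identityʳ
        ; length-applyUpTo; length-applyDownFrom; length-tabulate )
open import Data.List.Membership.Propositional using (_∈_; _∉_)
open import Data.List.Membership.Propositional.Properties
  using (∈-∃++; ∈-++⁺ˡ; ∈-++⁺ʳ; ∈-map⁺; ∈-applyUpTo⁺; ∈-applyDownFrom⁺)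
open import Data.List.Relation.Binary.Subset.Propositional using (_⊆_)
open import Data.List.Relation.Binary.Subset.Propositional.Properties
  using (⊆∷∧∉⇒⊆; ⊆∷⇒∈∨⊆; ⊆-respʳ-↭; ⊆-trans; ⊆-refl; ∈-∷⁺ʳ; ++⁺ʳ; xs⊆x∷xs)
open import Data.List.Relation.Binary.Permutation.Propositional.Properties using (shift)
open import Data.List.Relation.Binary.Disjoint.Propositional using (Disjoint)
open import Data.List.Relation.Unary.Any using (here; there)
open import Data.List.Relation.Unary.All using (All; []; _∷_; lookup)
import Data.List.Relation.Unary.All as All
import Data.List.Relation.Unary.All.Properties as AllP
open import Data.List.Relation.Unary.AllPairs using ([]; _∷_)
open import Data.List.Relation.Unary.Unique.Propositional using (Unique)
open import Data.List.Relation.Unary.Unique.Propositional.Properties using (cartesianProduct⁺; allFin⁺)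
open import Data.Product using (_×_; _,_; ∃; ∃₂; proj₁)
import Data.Product as Product
open import Data.Sum using (_⊎_; inj₁; inj₂)
import Data.Sum as Sum
open import Data.Unit using (tt)
open import Data.Empty using (⊥; ⊥-elim)
open import Function using (_∘_; id)
open import Relation.Nullary using (yes; no)
open import Relation.Unary using (U)
open import Relation.Binary.Definitions using (tri<; tri≈; tri>)
open import Relation.Binary.PropositionalEquality
  using (_≡_; _≢_; refl; sym; trans; cong; cong₂; subst; subst₂; module ≡-Reasoning)

data Route {V : Set} (E : V → V → Set) : V → List V → V → Set where
  []  : ∀ {s} → Route E s [] s
  _∷_ : ∀ {s x xs t} → E s x → Route E x xs t → Route E s (x ∷ xs) t

module _ {V : Set} {E : V → V → Set} where

  Route-++ : ∀ {s xs t ys u} → Route E s xs t → Route E t ys u → Route E s (xs ++ ys) u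
  Route-++ []      q = q
  Route-++ (e ∷ p) q = e ∷ Route-++ p q

  Route-end∈ : ∀ {s x xs t} → Route E s (x ∷ xs) t → t ∈ x ∷ xs
  Route-end∈ (e ∷ [])          = here refl
  Route-end∈ (e ∷ p@(_ ∷ _)) = there (Route-end∈ p)

  Route⇒Walk : ∀ {s xs t u} → Route E s xs t → E t u → Walk E (s ∷ xs ++ [ u ])
  Route⇒Walk []      e′ = e′ , tt
  Route⇒Walk (e ∷ p) e′ = e , Route⇒Walk p e′

  Route⇒ClosedWalk : ∀ {t x xs} → Route E t (x ∷ xs) t → ClosedWalk E (x ∷ xs)
  Route⇒ClosedWalk (e ∷ p) = Route⇒Walk p e

  Route-applyUpTo : ∀ {s} (f : ℕ → V) → (∀ t → E (f t) (f (suc t))) →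
                    ∀ k → E s (f 0) → Route E s (applyUpTo f (suc k)) (f k)
  Route-applyUpTo f step zero    e = e ∷ []
  Route-applyUpTo f step (suc k) e = e ∷ Route-applyUpTo (f ∘ suc) (step ∘ suc) k (step 0)

  Route-applyDownFrom : ∀ {s} (f : ℕ → V) → (∀ t → E (f (suc t)) (f t)) →
                        ∀ k → E s (f k) → Route E s (applyDownFrom f (suc k)) (f 0)
  Route-applyDownFrom f step zero    e = e ∷ []
  Route-applyDownFrom f step (suc k) e = e ∷ Route-applyDownFrom f step k (step k)

Route-map : ∀ {V W : Set} {E : V → V → Set} {F : W → W → Set} {P : V → Set} (φ : V → W) →
            (∀ {x y} → P x → P y → E x y → F (φ x) (φ y)) →
            ∀ {s xs t} → P s → All P xs → Route E s xs t → Route F (φ s) (map φ xs) (φ t)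
Route-map φ hom Ps []         []      = []
Route-map φ hom Ps (Px ∷ Pxs) (e ∷ p) = hom Ps Px e ∷ Route-map φ hom Px Pxs p

module _ {A : Set} where

  Unique-++⁻ˡ : ∀ xs {ys : List A} → Unique (xs ++ ys) → Unique xs
  Unique-++⁻ˡ []       _       = []
  Unique-++⁻ˡ (x ∷ xs) (h ∷ u) = AllP.++⁻ˡ xs h ∷ Unique-++⁻ˡ xs u

  Unique-++⁻ʳ : ∀ xs {ys : List A} → Unique (xs ++ ys) → Unique ys
  Unique-++⁻ʳ []       u       = u
  Unique-++⁻ʳ (x ∷ xs) (h ∷ u) = Unique-++⁻ʳ xs u

  Unique-++⇒Disjoint : ∀ xs {ys : List A} → Unique (xs ++ ys) → Disjoint xs ys
  Unique-++⇒Disjoint (x ∷ xs) (h ∷ u) (here refl  , y∈ys) = lookup h (∈-++⁺ʳ xs y∈ys) refl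
  Unique-++⇒Disjoint (x ∷ xs) (h ∷ u) (there y∈xs , y∈ys) = Unique-++⇒Disjoint xs u (y∈xs , y∈ys)

  Unique-++-∷⁻ : ∀ xs {x : A} {ys} → Unique (xs ++ x ∷ ys) → x ∉ xs ++ ys × Unique (xs ++ ys)
  Unique-++-∷⁻ []       (h ∷ u) = (λ x∈ys → lookup h x∈ys refl) , u
  Unique-++-∷⁻ (z ∷ xs) (h ∷ u) with AllP.++⁻ xs h | Unique-++-∷⁻ xs u
  ... | h₁ , z≢x ∷ h₂ | x∉ , u′ =
    (λ { (here x≡z) → z≢x (sym x≡z) ; (there x∈) → x∉ x∈ }) , AllP.++⁺ h₁ h₂ ∷ u′

  Unique-⊆⇒length≤ : ∀ {xs ys : List A} → Unique xs → xs ⊆ ys → length xs ≤ length ys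
  Unique-⊆⇒length≤ {[]}     _       _       = z≤n
  Unique-⊆⇒length≤ {x ∷ xs} (h ∷ u) x∷xs⊆ys with ∈-∃++ (x∷xs⊆ys (here refl))
  ... | zs , ws , refl = begin
    suc (length xs)         ≤⟨ s≤s (Unique-⊆⇒length≤ u xs⊆zs++ws) ⟩
    suc (length (zs ++ ws)) ≡⟨ length-++-sucʳ zs x ws ⟨
    length (zs ++ x ∷ ws)   ∎
    where
    open ≤-Reasoning
    xs⊆zs++ws : xs ⊆ zs ++ ws
    xs⊆zs++ws = ⊆∷∧∉⇒⊆ (⊆-respʳ-↭ (shift x zs ws) (x∷xs⊆ys ∘ there)) (AllP.All¬⇒¬Any h)

  ⊇-length≤⇒Unique : ∀ {xs ys : List A} → Unique ys → ys ⊆ xs → length xs ≤ length ys →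
                     Unique xs
  ⊇-length≤⇒Unique {[]}     _ _ _ = []
  ⊇-length≤⇒Unique {x ∷ xs} {ys} u ys⊆x∷xs xs≤ys with ⊆∷⇒∈∨⊆ ys⊆x∷xs
  ... | inj₂ ys⊆xs = ⊥-elim (<⇒≱ xs≤ys (Unique-⊆⇒length≤ u ys⊆xs))
  ... | inj₁ x∈ys  = AllP.¬Any⇒All¬ xs x∉xs ∷ Unique-xs (∈-∃++ x∈ys)
    where
    x∉xs : x ∉ xs
    x∉xs x∈xs = <⇒≱ xs≤ys (Unique-⊆⇒length≤ u (⊆-trans ys⊆x∷xs (∈-∷⁺ʳ x∈xs ⊆-refl)))
    Unique-xs : ∃₂ (λ zs ws → ys ≡ zs ++ x ∷ ws) → Unique xs
    Unique-xs (zs , ws , refl) with Unique-++-∷⁻ zs u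
    ... | x∉zs++ws , u′ = ⊇-length≤⇒Unique u′
      (⊆∷∧∉⇒⊆ (⊆-trans (++⁺ʳ zs (xs⊆x∷xs ws x)) ys⊆x∷xs) x∉zs++ws)
      (≤-pred (subst (suc (length xs) ≤_) (length-++-sucʳ zs x ws) xs≤ys))

length-cartesianProduct : ∀ {A B : Set} (xs : List A) (ys : List B) →
                          length (cartesianProduct xs ys) ≡ length xs * length ys
length-cartesianProduct []       ys = refl
length-cartesianProduct (x ∷ xs) ys = trans (length-++ (map (x ,_) ys))
  (cong₂ _+_ (length-map (x ,_) ys) (length-cartesianProduct xs ys))

toℕ-mod : ∀ {i k} .{{_ : NonZero k}} → i < k → toℕ (i mod k) ≡ i
toℕ-mod i<k = trans (toℕ-fromℕ< _) (m<n⇒m%n≡m i<k)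

module _ {V : Set} (E : V → V → Set) (P : V → Set) where

  record Tour (c : List V) : Set where
    field
      long   : 3 ≤ length c
      closed : ∃ λ t → Route E t c t
      inside : All P c

  record SeparatingTours (N : ℕ) (a b : V) : Set where
    field
      {tour₁ tour₂} : List V
      isTour₁ : Tour tour₁
      isTour₂ : Tour tour₂
      covers  : ∀ {x} → P x → x ∈ tour₁ ⊎ x ∈ tour₂
      total≤  : length tour₁ + length tour₂ ≤ N
      a∈₁     : a ∈ tour₁
      b∈₂     : b ∈ tour₂

module _ {V : Set} {E : V → V → Set} {P : V → Set} {N : ℕ} where

  open SeparatingTours

  SeparatingTours-swap : ∀ {a b} → SeparatingTours E P N a b → SeparatingTours E P N b a
  SeparatingTours-swap S = record
    { isTour₁ = isTour₂ S
    ; isTour₂ = isTour₁ S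
    ; covers  = Sum.swap ∘ covers S
    ; total≤  = subst (_≤ N) (+-comm (length (tour₁ S)) _) (total≤ S)
    ; a∈₁     = b∈₂ S
    ; b∈₂     = a∈₁ S
    }

record GraphSurjection {V W : Set} (E : V → V → Set) (P : V → Set) (F : W → W → Set) (Q : W → Set)
                       (φ : V → W) : Set where
  field
    maps-to    : ∀ {x} → P x → Q (φ x)
    preserves  : ∀ {x y} → P x → P y → E x y → F (φ x) (φ y)
    surjective : ∀ {y} → Q y → ∃ λ x → P x × φ x ≡ y

module _ {V W : Set} {E : V → V → Set} {P : V → Set} {F : W → W → Set} {Q : W → Set}
         {φ : V → W} (Φ : GraphSurjection E P F Q φ) where

  open GraphSurjection Φ
  open SeparatingTours

  Tour-map : ∀ {c} → Tour E P c → Tour F Q (map φ c)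
  Tour-map {[]}        record { long = () }
  Tour-map {c@(_ ∷ _)} record { long = long ; closed = t , route ; inside = inside } = record
    { long   = subst (3 ≤_) (sym (length-map φ c)) long
    ; closed = φ t , Route-map φ preserves (lookup inside (Route-end∈ route)) inside route
    ; inside = AllP.map⁺ (All.map maps-to inside)
    }

  SeparatingTours-map : ∀ {N a b} → SeparatingTours E P N a b → SeparatingTours F Q N (φ a) (φ b)
  SeparatingTours-map {N} S = record
    { isTour₁ = Tour-map (isTour₁ S)
    ; isTour₂ = Tour-map (isTour₂ S)
    ; covers  = covers′
    ; total≤  = subst (_≤ N) (sym (cong₂ _+_ (length-map φ (tour₁ S)) (length-map φ (tour₂ S))))
                  (total≤ S)
    ; a∈₁     = ∈-map⁺ φ (a∈₁ S)
    ; b∈₂     = ∈-map⁺ φ (b∈₂ S)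
    }
    where
    covers′ : ∀ {y} → Q y → y ∈ map φ (tour₁ S) ⊎ y ∈ map φ (tour₂ S)
    covers′ Qy with surjective Qy
    ... | x , Px , refl = Sum.map (∈-map⁺ φ) (∈-map⁺ φ) (covers S Px)

module _ {V : Set} {E : V → V → Set} {P : V → Set} where

  open import Function.Endo.Propositional V using (_^_)

  GraphSurjection-id : GraphSurjection E P E P id
  GraphSurjection-id = record
    { maps-to = id ; preserves = λ _ _ → id ; surjective = λ {y} Py → y , Py , refl }

  GraphSurjection-∘ : ∀ {φ ψ : V → V} → GraphSurjection E P E P ψ → GraphSurjection E P E P φ →
                      GraphSurjection E P E P (ψ ∘ φ)
  GraphSurjection-∘ {ψ = ψ} Ψ Φ = record
    { maps-to    = Ψ.maps-to ∘ Φ.maps-to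
    ; preserves  = λ Px Py → Ψ.preserves (Φ.maps-to Px) (Φ.maps-to Py) ∘ Φ.preserves Px Py
    ; surjective = λ Pz → let y , Py , ψy≡z = Ψ.surjective Pz ; x , Px , φx≡y = Φ.surjective Py
                          in x , Px , trans (cong ψ φx≡y) ψy≡z
    }
    where
    module Ψ = GraphSurjection Ψ
    module Φ = GraphSurjection Φ

  GraphSurjection-^ : ∀ {φ : V → V} → GraphSurjection E P E P φ →
                      ∀ k → GraphSurjection E P E P (φ ^ k)
  GraphSurjection-^ Φ zero    = GraphSurjection-id
  GraphSurjection-^ Φ (suc k) = GraphSurjection-∘ Φ (GraphSurjection-^ Φ k)

module _ {V : Set} {E : V → V → Set} where

  open SeparatingTours

  Tour⇒IsCycle : ∀ {c} → Tour E U c → Unique c → IsCycle E c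
  Tour⇒IsCycle {[]}    record { long = () }
  Tour⇒IsCycle {_ ∷ _} record { long = long ; closed = _ , route } u =
    long , u , Route⇒ClosedWalk route

  SeparatingTours⇒Separates : ∀ {vs : List V} {N} → Unique vs → N ≤ length vs → ∀ {a b} →
                              SeparatingTours E U N a b → ∃ (Separates E 2 (a ∷ b ∷ []))
  SeparatingTours⇒Separates {vs} vs-unique N≤ {a} {b} S =
    (c₁ ∷ c₂ ∷ []) ,
    ((Tour⇒IsCycle (isTour₁ S) c₁-unique ∷ Tour⇒IsCycle (isTour₂ S) c₂-unique ∷ []) ,
     c₁c₂-unique , covers-all) ,
    refl , meets₁ ∷ meets₂ ∷ []
    where
    c₁ c₂ : List V
    c₁ = tour₁ S
    c₂ = tour₂ S
    covers-all : ∀ v → v ∈ c₁ ++ c₂ ++ []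
    covers-all v with covers S tt
    ... | inj₁ v∈c₁ = ∈-++⁺ˡ v∈c₁
    ... | inj₂ v∈c₂ = ∈-++⁺ʳ c₁ (∈-++⁺ˡ v∈c₂)
    length-c₁c₂ : length (c₁ ++ c₂ ++ []) ≡ length c₁ + length c₂
    length-c₁c₂ = trans (length-++ c₁) (cong (length c₁ +_) (cong length (++-identityʳ c₂)))
    c₁c₂-unique : Unique (c₁ ++ c₂ ++ [])
    c₁c₂-unique = ⊇-length≤⇒Unique vs-unique (λ {v} _ → covers-all v)
      (≤-trans (≤-reflexive length-c₁c₂) (≤-trans (total≤ S) N≤))
    c₁-unique : Unique c₁
    c₁-unique = Unique-++⁻ˡ c₁ c₁c₂-unique
    c₂-unique : Unique c₂
    c₂-unique = Unique-++⁻ˡ c₂ (Unique-++⁻ʳ c₁ c₁c₂-unique)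
    disjoint : ∀ {v} → v ∈ c₁ → v ∈ c₂ → ⊥
    disjoint v∈c₁ v∈c₂ = Unique-++⇒Disjoint c₁ c₁c₂-unique (v∈c₁ , ∈-++⁺ˡ v∈c₂)
    meets₁ : MeetsOnce (a ∷ b ∷ []) c₁
    meets₁ = a , here refl , a∈₁ S , λ
      { _ (here refl)         _    → refl
      ; _ (there (here refl)) b∈c₁ → ⊥-elim (disjoint b∈c₁ (b∈₂ S)) }
    meets₂ : MeetsOnce (a ∷ b ∷ []) c₂
    meets₂ = b , there (here refl) , b∈₂ S , λ
      { _ (here refl)         a∈c₂ → ⊥-elim (disjoint (a∈₁ S) a∈c₂)
      ; _ (there (here refl)) _    → refl }

-- Definitionally, PathAdj m i i′ is PathAdjℕ (toℕ i) (toℕ i′), and likewise for CycleAdj n.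
PathAdjℕ : ℕ → ℕ → Set
PathAdjℕ i i′ = (suc i ≡ i′) ⊎ (suc i′ ≡ i)

CycleAdjℕ : ℕ → ℕ → ℕ → Set
CycleAdjℕ n j j′ =
  (suc j ≡ j′) ⊎ (suc j′ ≡ j) ⊎ (suc j ≡ n × j′ ≡ 0) ⊎ (suc j′ ≡ n × j ≡ 0)

GridAdj : ℕ → ℕ × ℕ → ℕ × ℕ → Set
GridAdj n = Box PathAdjℕ (CycleAdjℕ n)

InGrid : ℕ → ℕ → ℕ × ℕ → Set
InGrid m n (i , j) = i < m × j < n

module Grid (m n′ : ℕ) where

  n lastCol : ℕ
  n       = 4 + n′
  lastCol = 3 + n′

  Cell : Set
  Cell = ℕ × ℕ

  open import Function.Endo.Propositional Cell using (_^_)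

  Adj : Cell → Cell → Set
  Adj = GridAdj n

  Inside : Cell → Set
  Inside = InGrid m n

  Separation : Cell → Cell → Set
  Separation = SeparatingTours Adj Inside (m * n)

  module _ {i j : ℕ} where

    right : Adj (i , j) (i , suc j)
    right = inj₁ (refl , inj₁ refl)

    left : Adj (i , suc j) (i , j)
    left = inj₁ (refl , inj₂ (inj₁ refl))

    down : Adj (i , j) (suc i , j)
    down = inj₂ (inj₁ refl , refl)

    up : Adj (suc i , j) (i , j)
    up = inj₂ (inj₂ refl , refl)

  wrapʳ : ∀ {i} → Adj (i , lastCol) (i , 0)
  wrapʳ = inj₁ (refl , inj₂ (inj₂ (inj₁ (refl , refl))))

  wrapˡ : ∀ {i} → Adj (i , 0) (i , lastCol)
  wrapˡ = inj₁ (refl , inj₂ (inj₂ (inj₂ (refl , refl))))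

  Route-endRow : ∀ {x xs r r′ j} → r ≡ r′ → Route Adj x xs (r , j) → Route Adj x xs (r′ , j)
  Route-endRow refl route = route

  row : Bool → ℕ → ℕ → List Cell
  row true  i w = applyUpTo     (λ c → i , suc c) w
  row false i w = applyDownFrom (λ c → i , suc c) w

  entry : Bool → ℕ → ℕ
  entry true  w = 1
  entry false w = w

  Route-row : ∀ {x} d i w → Adj x (i , entry d (suc w)) →
              Route Adj x (row d i (suc w)) (i , entry (not d) (suc w))
  Route-row true  i w = Route-applyUpTo     (λ c → i , suc c) (λ _ → right) w
  Route-row false i w = Route-applyDownFrom (λ c → i , suc c) (λ _ → left) w

  ∈-row : ∀ d i {w c} → c < w → (i , suc c) ∈ row d i w
  ∈-row true  i = ∈-applyUpTo⁺     (λ c → i , suc c)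
  ∈-row false i = ∈-applyDownFrom⁺ (λ c → i , suc c)

  length-row : ∀ d i w → length (row d i w) ≡ w
  length-row true  i = length-applyUpTo     (λ c → i , suc c)
  length-row false i = length-applyDownFrom (λ c → i , suc c)

  All-row : ∀ d {i w} → i < m → w < n → All Inside (row d i w)
  All-row true  {i} {w} i<m w<n =
    AllP.applyUpTo⁺₁     (λ c → i , suc c) w (λ c<w → i<m , <-≤-trans (s≤s c<w) w<n)
  All-row false {i} {w} i<m w<n =
    AllP.applyDownFrom⁺₁ (λ c → i , suc c) w (λ c<w → i<m , <-≤-trans (s≤s c<w) w<n)

  snake : Bool → ℕ → ℕ → ℕ → List Cell
  snake d p zero    w = []
  snake d p (suc k) w = row d p w ++ snake (not d) (suc p) k w

  lastDir : Bool → ℕ → Bool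
  lastDir d zero    = d
  lastDir d (suc k) = lastDir (not d) k

  Route-snake : ∀ {x} d p k w → Adj x (p , entry d (suc w)) →
                Route Adj x (snake d p (suc k) (suc w)) (k + p , entry (not (lastDir d k)) (suc w))
  Route-snake d p zero    w a = Route-++ (Route-row d p w a) []
  Route-snake d p (suc k) w a = Route-++ (Route-row d p w a)
    (Route-endRow (+-suc k p) (Route-snake (not d) (suc p) k w down))

  ∈-snake : ∀ d {p r c} k w → p ≤ r → r < k + p → c < w → (r , suc c) ∈ snake d p k w
  ∈-snake d zero w p≤r r<p _ = ⊥-elim (<⇒≱ r<p p≤r)
  ∈-snake d {p} {r} (suc k) w p≤r r<1+k+p c<w with m≤n⇒m<n∨m≡n p≤r
  ... | inj₂ refl = ∈-++⁺ˡ (∈-row d p c<w)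
  ... | inj₁ p<r  = ∈-++⁺ʳ (row d p w)
    (∈-snake (not d) k w p<r (subst (r <_) (sym (+-suc k p)) r<1+k+p) c<w)

  length-snake : ∀ d p k w → length (snake d p k w) ≡ k * w
  length-snake d p zero    w = refl
  length-snake d p (suc k) w = trans (length-++ (row d p w))
    (cong₂ _+_ (length-row d p w) (length-snake (not d) (suc p) k w))

  All-snake : ∀ d p k {w} → k + p ≤ m → w < n → All Inside (snake d p k w)
  All-snake d p zero    _       _   = []
  All-snake d p (suc k) 1+k+p≤m w<n = AllP.++⁺
    (All-row d (≤-<-trans (m≤n+m p k) 1+k+p≤m) w<n)
    (All-snake (not d) (suc p) k (subst (_≤ m) (sym (+-suc k p)) 1+k+p≤m) w<n)

  column : ℕ → ℕ → List Cell
  column p k = applyDownFrom (λ t → t + p , 0) k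

  Route-column : ∀ {x} p k → Adj x (k + p , 0) → Route Adj x (column p (suc k)) (p , 0)
  Route-column p = Route-applyDownFrom (λ t → t + p , 0) (λ _ → up)

  ∈-column : ∀ {p r} k → p ≤ r → r < k + p → (r , 0) ∈ column p k
  ∈-column zero    p≤r r<p     = ⊥-elim (<⇒≱ r<p p≤r)
  ∈-column (suc k) p≤r r<1+k+p with m≤n⇒m<n∨m≡n (≤-pred r<1+k+p)
  ... | inj₂ refl  = here refl
  ... | inj₁ r<k+p = there (∈-column k p≤r r<k+p)

  length-column : ∀ p k → length (column p k) ≡ k
  length-column p = length-applyDownFrom (λ t → t + p , 0)

  All-column : ∀ p k → k + p ≤ m → All Inside (column p k)
  All-column p k k+p≤m = AllP.applyDownFrom⁺₁ (λ t → t + p , 0) k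
    (λ t<k → <-≤-trans (+-monoˡ-< p t<k) k+p≤m , s≤s z≤n)

  toColumn0 : ∀ d {i} → Adj (i , entry d lastCol) (i , 0)
  toColumn0 true  = left
  toColumn0 false = wrapʳ

  fromColumn0 : ∀ d {i} → Adj (i , 0) (i , entry d lastCol)
  fromColumn0 true  = right
  fromColumn0 false = wrapˡ

  band : ℕ → ℕ → List Cell
  band p k = snake true p (suc k) lastCol ++ column p (suc k)

  Route-band : ∀ {x} p k → Adj x (p , 1) → Route Adj x (band p k) (p , 0)
  Route-band p k a =
    Route-++ (Route-snake true p k (2 + n′) a) (Route-column p k (toColumn0 _))

  ∈-band : ∀ {p r c} k → p ≤ r → r ≤ k + p → c < n → (r , c) ∈ band p k
  ∈-band {c = zero}  k p≤r r≤k+p _   =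
    ∈-++⁺ʳ (snake true _ (suc k) lastCol) (∈-column (suc k) p≤r (s≤s r≤k+p))
  ∈-band {c = suc c} k p≤r r≤k+p c<n =
    ∈-++⁺ˡ (∈-snake true (suc k) lastCol p≤r (s≤s r≤k+p) (≤-pred c<n))

  length-band : ∀ p k → length (band p k) ≡ suc k * n
  length-band p k = begin
    length (snake true p (suc k) lastCol ++ column p (suc k))
      ≡⟨ length-++ (snake true p (suc k) lastCol) ⟩
    length (snake true p (suc k) lastCol) + length (column p (suc k))
      ≡⟨ cong₂ _+_ (length-snake true p (suc k) lastCol) (length-column p (suc k)) ⟩
    suc k * lastCol + suc k
      ≡⟨ +-comm (suc k * lastCol) (suc k) ⟩
    suc k + suc k * lastCol
      ≡⟨ *-suc (suc k) lastCol ⟨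
    suc k * n ∎
    where open ≡-Reasoning

  Tour-band : ∀ p k → k + p < m → Tour Adj Inside (band p k)
  Tour-band p k k+p<m = record
    { long   = subst (3 ≤_) (sym (length-band p k)) (m≤m+n 3 _)
    ; closed = (p , 0) , Route-band p k right
    ; inside = AllP.++⁺ (All-snake true p (suc k) k+p<m ≤-refl) (All-column p (suc k) k+p<m)
    }

  leftEnding : ℕ → Bool
  leftEnding zero    = false
  leftEnding (suc k) = not (leftEnding k)

  lastDir-leftEnding : ∀ k → lastDir (leftEnding k) k ≡ false
  lastDir-leftEnding zero    = refl
  lastDir-leftEnding (suc k) rewrite not-involutive (leftEnding k) = lastDir-leftEnding k

  top : ℕ → List Cell
  top zero    = []
  top (suc s) = snake (leftEnding s) 0 (suc s) lastCol

  Route-top : ∀ s → ∃ λ x → Route Adj (0 , 0) (top s) x × Adj x (s , 1)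
  Route-top zero    = (0 , 0) , [] , right
  Route-top (suc s) = (s , 1) , Route-endRow (+-identityʳ s) route , down
    where
    route : Route Adj (0 , 0) (top (suc s)) (s + 0 , 1)
    route = subst (λ d → Route Adj (0 , 0) (top (suc s)) (s + 0 , entry (not d) lastCol))
                  (lastDir-leftEnding s)
                  (Route-snake (leftEnding s) 0 s (2 + n′) (fromColumn0 (leftEnding s)))

  ∈-top : ∀ {s r c} → r < s → c < lastCol → (r , suc c) ∈ top s
  ∈-top {suc s} {r} r<s c<lastCol = ∈-snake (leftEnding s) (suc s) lastCol z≤n
    (subst (r <_) (sym (+-identityʳ (suc s))) r<s) c<lastCol

  length-top : ∀ s → length (top s) ≡ s * lastCol
  length-top zero    = refl
  length-top (suc s) = length-snake (leftEnding s) 0 (suc s) lastCol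

  All-top : ∀ s → s ≤ m → All Inside (top s)
  All-top zero    _   = []
  All-top (suc s) s≤m =
    All-snake (leftEnding s) 0 (suc s) (subst (_≤ m) (sym (+-identityʳ (suc s))) s≤m) ≤-refl

  Route-bottom : ∀ p K → ∃ λ y → Route Adj (p , 1) (snake true (suc p) K lastCol) y × Adj y (K + p , 0)
  Route-bottom p zero    = (p , 1) , [] , left
  Route-bottom p (suc K) =
    _ , Route-endRow (+-suc K p) (Route-snake true (suc p) K (2 + n′) down) , toColumn0 _

  CycleAdj-sym : ∀ {j j′} → CycleAdjℕ n j j′ → CycleAdjℕ n j′ j
  CycleAdj-sym (inj₁ e)               = inj₂ (inj₁ e)
  CycleAdj-sym (inj₂ (inj₁ e))        = inj₁ e
  CycleAdj-sym (inj₂ (inj₂ (inj₁ e))) = inj₂ (inj₂ (inj₂ e))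
  CycleAdj-sym (inj₂ (inj₂ (inj₂ e))) = inj₂ (inj₂ (inj₁ e))

  next : ℕ → ℕ
  next j = suc j % n

  next<n : ∀ j → next j < n
  next<n j = m%n<n (suc j) n

  next-< : ∀ {j} → j < lastCol → next j ≡ suc j
  next-< j<lastCol = m<n⇒m%n≡m (s≤s j<lastCol)

  next-lastCol : next lastCol ≡ 0
  next-lastCol = n%n≡0 n

  CycleAdj-next : ∀ {j} → j < n → CycleAdjℕ n j (next j)
  CycleAdj-next j<n with m≤n⇒m<n∨m≡n (≤-pred j<n)
  ... | inj₁ j<lastCol rewrite next-< j<lastCol = inj₁ refl
  ... | inj₂ refl      rewrite next-lastCol      = inj₂ (inj₂ (inj₁ (refl , refl)))

  CycleAdj⇒next : ∀ {j j′} → j < n → j′ < n → CycleAdjℕ n j j′ → j′ ≡ next j ⊎ j ≡ next j′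
  CycleAdj⇒next _   j′<n (inj₁ refl)                         = inj₁ (sym (next-< (≤-pred j′<n)))
  CycleAdj⇒next j<n _    (inj₂ (inj₁ refl))                  = inj₂ (sym (next-< (≤-pred j<n)))
  CycleAdj⇒next _   _    (inj₂ (inj₂ (inj₁ (refl , refl)))) = inj₁ (sym next-lastCol)
  CycleAdj⇒next _   _    (inj₂ (inj₂ (inj₂ (refl , refl)))) = inj₂ (sym next-lastCol)

  next-preserves : ∀ {j j′} → j < n → j′ < n → CycleAdjℕ n j j′ → CycleAdjℕ n (next j) (next j′)
  next-preserves {j} {j′} j<n j′<n adj with CycleAdj⇒next j<n j′<n adj
  ... | inj₁ refl = CycleAdj-next (next<n j)
  ... | inj₂ refl = CycleAdj-sym (CycleAdj-next (next<n j′))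

  rotate : Cell → Cell
  rotate (i , j) = i , next j

  rotate-surjection : GraphSurjection Adj Inside Adj Inside rotate
  rotate-surjection = record { maps-to = maps-to ; preserves = preserves ; surjective = surjective }
    where
    maps-to : ∀ {x} → Inside x → Inside (rotate x)
    maps-to {_ , j} (i<m , _) = i<m , next<n j
    preserves : ∀ {x y} → Inside x → Inside y → Adj x y → Adj (rotate x) (rotate y)
    preserves (_ , j<n) (_ , j′<n) (inj₁ (i≡i′ , adj)) = inj₁ (i≡i′ , next-preserves j<n j′<n adj)
    preserves _         _          (inj₂ (adj , j≡j′)) = inj₂ (adj , cong next j≡j′)
    surjective : ∀ {y} → Inside y → ∃ λ x → Inside x × rotate x ≡ y
    surjective {i , zero}  (i<m , _)   =
      (i , lastCol) , (i<m , ≤-refl) , cong (i ,_) next-lastCol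
    surjective {i , suc c} (i<m , c<n) =
      (i , c) , (i<m , <-trans (n<1+n c) c<n) , cong (i ,_) (next-< (≤-pred c<n))

  rotate^ : ∀ k {i j} → k + j < n → (rotate ^ k) (i , j) ≡ (i , k + j)
  rotate^ zero            _     = refl
  rotate^ (suc k) {i} {j} k+j<n = begin
    rotate ((rotate ^ k) (i , j)) ≡⟨ cong rotate (rotate^ k (<-trans (n<1+n _) k+j<n)) ⟩
    rotate (i , k + j)            ≡⟨ cong (i ,_) (next-< (≤-pred k+j<n)) ⟩
    (i , suc k + j)               ∎
    where open ≡-Reasoning

  rotate^-Separation : ∀ k {i j₁ j₂} → k + j₁ < n → k + j₂ < n →
                       Separation (i , j₁) (i , j₂) → Separation (i , k + j₁) (i , k + j₂)
  rotate^-Separation k k+j₁<n k+j₂<n S = subst₂ Separation (rotate^ k k+j₁<n) (rotate^ k k+j₂<n)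
    (SeparatingTours-map (GraphSurjection-^ rotate-surjection k) S)

  sameRow-byRotation : ∀ {r} → (∀ {c} → c < 2 + n′ → Separation (r , lastCol) (r , c)) →
                       ∀ {c₁ c₂} → c₁ < c₂ → c₂ < n → Separation (r , c₁) (r , c₂)
  sameRow-byRotation {r} core {c₁} c₁<c₂ c₂<n with m≤n⇒∃[o]m+o≡n c₁<c₂
  ... | c , refl with c <? 2 + n′
  ... | yes c<n-2 = subst₂ Separation (cong (r ,_) (+-identityʳ c₁)) (cong (r ,_) (+-suc c₁ c))
    (rotate^-Separation c₁ (subst (_< n) (sym (+-identityʳ c₁)) (<-trans c₁<c₂ c₂<n))
                           (subst (_< n) (sym (+-suc c₁ c)) c₂<n) once)
    where
    once : Separation (r , 0) (r , suc c)
    once = subst₂ Separation (cong (r ,_) next-lastCol) (cong (r ,_) (next-< (<-trans c<n-2 (n<1+n _))))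
             (SeparatingTours-map rotate-surjection (core c<n-2))
  ... | no  c≮n-2 = wrapAround c₁ (≮⇒≥ c≮n-2) c₂<n
    where
    -- Here (c₁ , c₂) = (0 , n - 1), the pair (n - 1 , 0) of core read backwards.
    wrapAround : ∀ c₁ → 2 + n′ ≤ c → suc c₁ + c < n → Separation (r , c₁) (r , suc c₁ + c)
    wrapAround zero    n-2≤c c₂<n with ≤-antisym (≤-pred (≤-pred c₂<n)) n-2≤c
    ... | refl = SeparatingTours-swap (core (s≤s z≤n))
    wrapAround (suc a) n-2≤c c₂<n =
      ⊥-elim (1+n≰n (≤-trans n-2≤c (≤-trans (m≤n+m c a) (≤-pred (≤-pred (≤-pred c₂<n))))))

module TwoBands (t k n′ : ℕ) where

  open Grid (suc (k + suc t)) n′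

  separation : ∀ {r₁ c₁ r₂ c₂} → r₁ ≤ t → t < r₂ → Inside (r₁ , c₁) → Inside (r₂ , c₂) →
               Separation (r₁ , c₁) (r₂ , c₂)
  separation r₁≤t t<r₂ (_ , c₁<n) (r₂<m , c₂<n) = record
    { isTour₁ = Tour-band 0 t t<m
    ; isTour₂ = Tour-band (suc t) k ≤-refl
    ; covers  = covers
    ; total≤  = ≤-reflexive total
    ; a∈₁     = ∈-band t z≤n (upper r₁≤t) c₁<n
    ; b∈₂     = ∈-band k t<r₂ (≤-pred r₂<m) c₂<n
    }
    where
    upper : ∀ {r} → r ≤ t → r ≤ t + 0
    upper = subst (_ ≤_) (sym (+-identityʳ t))
    t<m : t + 0 < suc (k + suc t)
    t<m = s≤s (subst (_≤ k + suc t) (sym (+-identityʳ t)) (≤-trans (n≤1+n t) (m≤n+m (suc t) k)))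
    covers : ∀ {x} → Inside x → x ∈ band 0 t ⊎ x ∈ band (suc t) k
    covers {r , c} (r<m , c<n) with r ≤? t
    ... | yes r≤t = inj₁ (∈-band t z≤n (upper r≤t) c<n)
    ... | no  r≰t = inj₂ (∈-band k (≰⇒> r≰t) (≤-pred r<m) c<n)
    total : length (band 0 t) + length (band (suc t) k) ≡ suc (k + suc t) * n
    total = begin
      length (band 0 t) + length (band (suc t) k) ≡⟨ cong₂ _+_ (length-band 0 t) (length-band (suc t) k) ⟩
      suc t * n + suc k * n                       ≡⟨ *-distribʳ-+ n (suc t) (suc k) ⟨
      (suc t + suc k) * n                         ≡⟨ cong (_* n) (+-comm (suc t) (suc k)) ⟩
      suc (k + suc t) * n                         ∎
      where open ≡-Reasoning

module SquareAndComplement (s K n′ : ℕ) where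

  open Grid (suc (K + suc s)) n′

  square : List Cell
  square = (s , 2 + n′) ∷ (s , lastCol) ∷ (suc s , lastCol) ∷ (suc s , 2 + n′) ∷ []

  middle bottom rest complement : List Cell
  middle     = snake true s 2 (1 + n′)
  bottom     = snake true (2 + s) K lastCol
  rest       = middle ++ bottom ++ column 0 (suc (K + suc s))
  complement = top s ++ rest

  Route-complement : Route Adj (0 , 0) complement (0 , 0)
  Route-complement with Route-top s | Route-bottom (suc s) K
  ... | _ , top-route , top→s | y , bottom-route , bottom→column =
    Route-++ top-route (Route-++ (Route-snake true s 1 n′ top→s) (Route-++ bottom-route
      (Route-column 0 (K + suc s)
        (subst (λ r → Adj y (r , 0)) (sym (+-identityʳ (K + suc s))) bottom→column))))

  length-complement :
    length complement ≡ s * lastCol + (2 * (1 + n′) + (K * lastCol + suc (K + suc s)))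
  length-complement = begin
    length (top s ++ rest)
      ≡⟨ length-++ (top s) ⟩
    length (top s) + length rest
      ≡⟨ cong₂ _+_ (length-top s) (length-++ middle) ⟩
    s * lastCol + (length middle + length (bottom ++ column 0 (suc (K + suc s))))
      ≡⟨ cong (λ l → s * lastCol + (length middle + l)) (length-++ bottom) ⟩
    s * lastCol + (length middle + (length bottom + length (column 0 (suc (K + suc s)))))
      ≡⟨ cong (s * lastCol +_) (cong₂ _+_ (length-snake true s 2 (1 + n′))
           (cong₂ _+_ (length-snake true (2 + s) K lastCol) (length-column 0 (suc (K + suc s))))) ⟩
    s * lastCol + (2 * (1 + n′) + (K * lastCol + suc (K + suc s))) ∎
    where open ≡-Reasoning

  1+s<m : suc s < suc (K + suc s)
  1+s<m = s≤s (m≤n+m (suc s) K)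

  s<m : s < suc (K + suc s)
  s<m = <-trans (n<1+n s) 1+s<m

  Tour-square : Tour Adj Inside square
  Tour-square = record
    { long   = s≤s (s≤s (s≤s z≤n))
    ; closed = (suc s , 2 + n′) , up ∷ right ∷ down ∷ left ∷ []
    ; inside = (s<m , n-2<n) ∷ (s<m , ≤-refl) ∷ (1+s<m , ≤-refl) ∷ (1+s<m , n-2<n) ∷ []
    }
    where
    n-2<n : 2 + n′ < n
    n-2<n = ≤-trans (n<1+n (2 + n′)) (n≤1+n _)

  Tour-complement : Tour Adj Inside complement
  Tour-complement = record
    { long   = subst (3 ≤_) (sym (trans length-complement (shape s K n′))) (m≤m+n 3 _)
    ; closed = (0 , 0) , Route-complement
    ; inside = AllP.++⁺ (All-top s (<⇒≤ s<m))
                 (AllP.++⁺ (All-snake true s 2 1+s<m (≤-trans (n≤1+n _) (n≤1+n _)))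
                   (AllP.++⁺ (All-snake true (2 + s) K (≤-reflexive (+-suc K (suc s))) ≤-refl)
                     (All-column 0 (suc (K + suc s)) (≤-reflexive (+-identityʳ _)))))
    }
    where
    shape : ∀ s K n′ → s * (3 + n′) + (2 * (1 + n′) + (K * (3 + n′) + suc (K + suc s)))
                     ≡ 3 + (s * (3 + n′) + (2 * n′ + (K * (3 + n′) + (K + suc s))))
    shape = solve-∀

  ∈-square : ∀ {r c} → r ≡ s ⊎ r ≡ suc s → c ≡ 1 + n′ ⊎ c ≡ 2 + n′ → (r , suc c) ∈ square
  ∈-square (inj₁ refl) (inj₁ refl) = here refl
  ∈-square (inj₁ refl) (inj₂ refl) = there (here refl)
  ∈-square (inj₂ refl) (inj₂ refl) = there (there (here refl))
  ∈-square (inj₂ refl) (inj₁ refl) = there (there (there (here refl)))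

  ∈-rest : ∀ {x} → x ∈ rest → x ∈ complement
  ∈-rest = ∈-++⁺ʳ (top s)

  ∈-complement-column : ∀ {r} → r < suc (K + suc s) → (r , 0) ∈ complement
  ∈-complement-column {r} r<m = ∈-rest (∈-++⁺ʳ middle (∈-++⁺ʳ bottom
    (∈-column (suc (K + suc s)) z≤n (subst (r <_) (sym (+-identityʳ _)) r<m))))

  ∈-complement-beside : ∀ {r c} → r ≡ s ⊎ r ≡ suc s → c < 2 + n′ → (r , c) ∈ complement
  ∈-complement-beside {c = zero}  (inj₁ refl) _     = ∈-complement-column s<m
  ∈-complement-beside {c = zero}  (inj₂ refl) _     = ∈-complement-column 1+s<m
  ∈-complement-beside {c = suc c} (inj₁ refl) c<n-2 =
    ∈-rest (∈-++⁺ˡ (∈-snake true 2 (1 + n′) ≤-refl (n≤1+n _) (≤-pred c<n-2)))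
  ∈-complement-beside {c = suc c} (inj₂ refl) c<n-2 =
    ∈-rest (∈-++⁺ˡ (∈-snake true 2 (1 + n′) (n≤1+n s) ≤-refl (≤-pred c<n-2)))

  covers-squareRows : ∀ {r c} → r ≡ s ⊎ r ≡ suc s → c < n →
                      (r , c) ∈ square ⊎ (r , c) ∈ complement
  covers-squareRows {c = c} r≡ c<n with c <? 2 + n′
  ... | yes c<n-2 = inj₂ (∈-complement-beside r≡ c<n-2)
  ... | no  c≮n-2 with m≤n⇒m<n∨m≡n (≮⇒≥ c≮n-2)
  ...   | inj₂ refl  = inj₁ (∈-square r≡ (inj₁ refl))
  ...   | inj₁ n-2<c with ≤-antisym (≤-pred c<n) n-2<c
  ...     | refl = inj₁ (∈-square r≡ (inj₂ refl))

  covers : ∀ {x} → Inside x → x ∈ square ⊎ x ∈ complement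
  covers {r , zero}  (r<m , _)   = inj₂ (∈-complement-column r<m)
  covers {r , suc c} (r<m , c<n) with <-cmp r s
  ... | tri< r<s _ _  = inj₂ (∈-++⁺ˡ (∈-top r<s (≤-pred c<n)))
  ... | tri≈ _ refl _ = covers-squareRows (inj₁ refl) c<n
  ... | tri> _ _ s<r with m≤n⇒m<n∨m≡n s<r
  ...   | inj₂ refl  = covers-squareRows (inj₂ refl) c<n
  ...   | inj₁ 1+s<r = inj₂ (∈-rest (∈-++⁺ʳ middle (∈-++⁺ˡ (∈-snake true K lastCol 1+s<r
                         (subst (r <_) (sym (+-suc K (suc s))) r<m) (≤-pred c<n)))))

  separation : ∀ {r c} → r ≡ s ⊎ r ≡ suc s → c < 2 + n′ → Separation (r , lastCol) (r , c)
  separation r≡ c<n-2 = record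
    { isTour₁ = Tour-square
    ; isTour₂ = Tour-complement
    ; covers  = covers
    ; total≤  = ≤-reflexive (trans (cong (4 +_) length-complement) (total s K n′))
    ; a∈₁     = ∈-square r≡ (inj₂ refl)
    ; b∈₂     = ∈-complement-beside r≡ c<n-2
    }
    where
    total : ∀ s K n′ → 4 + (s * (3 + n′) + (2 * (1 + n′) + (K * (3 + n′) + suc (K + suc s))))
                     ≡ suc (K + suc s) * (4 + n′)
    total = solve-∀

rows-split : ∀ {p m} → p < m → ∃ λ k → suc (k + p) ≡ m
rows-split {p} p<m with m≤n⇒∃[o]m+o≡n p<m
... | k , refl = k , cong suc (+-comm k p)

module _ {m : ℕ} (n′ : ℕ) where

  open Grid m n′ using (Separation; Inside; lastCol; sameRow-byRotation)

  distinctRows : ∀ {r₁ c₁ r₂ c₂} → r₁ < r₂ → Inside (r₁ , c₁) → Inside (r₂ , c₂) →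
                 Separation (r₁ , c₁) (r₂ , c₂)
  distinctRows {r₂ = suc t} (s≤s r₁≤t) a∈ b∈ with rows-split (proj₁ b∈)
  ... | k , refl = TwoBands.separation t k n′ r₁≤t ≤-refl a∈ b∈

  squareSeparation : 2 ≤ m → ∀ {r c} → r < m → c < 2 + n′ → Separation (r , lastCol) (r , c)
  squareSeparation 2≤m {r} r<m c<n-2 with suc r <? m
  ... | yes 1+r<m with rows-split 1+r<m
  ...   | K , refl = SquareAndComplement.separation r K n′ (inj₁ refl) c<n-2
  squareSeparation 2≤m {zero}  r<m c<n-2 | no 1+r≮m = ⊥-elim (1+r≮m 2≤m)
  squareSeparation 2≤m {suc s} r<m c<n-2 | no 1+r≮m with ≤-antisym r<m (≮⇒≥ 1+r≮m)
  ...   | refl = SquareAndComplement.separation s 0 n′ (inj₂ refl) c<n-2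

  gridSeparation : 2 ≤ m → ∀ {a b} → Inside a → Inside b → a ≢ b → Separation a b
  gridSeparation 2≤m {r₁ , c₁} {r₂ , c₂} a∈@(r₁<m , c₁<n) b∈@(_ , c₂<n) a≢b with <-cmp r₁ r₂
  ... | tri< r₁<r₂ _ _ = distinctRows r₁<r₂ a∈ b∈
  ... | tri> _ _ r₂<r₁ = SeparatingTours-swap (distinctRows r₂<r₁ b∈ a∈)
  ... | tri≈ _ refl _ with <-cmp c₁ c₂
  ...   | tri< c₁<c₂ _ _ = sameRow-byRotation (squareSeparation 2≤m r₁<m) c₁<c₂ c₂<n
  ...   | tri≈ _ refl _  = ⊥-elim (a≢b refl)
  ...   | tri> _ _ c₂<c₁ =
    SeparatingTours-swap (sameRow-byRotation (squareSeparation 2≤m r₁<m) c₂<c₁ c₁<n)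

module _ (m n : ℕ) .{{_ : NonZero m}} .{{_ : NonZero n}} where

  toCell : Fin m × Fin n → ℕ × ℕ
  toCell (i , j) = toℕ i , toℕ j

  fromCell : ℕ × ℕ → Fin m × Fin n
  fromCell (i , j) = i mod m , j mod n

  toCell-inside : ∀ x → InGrid m n (toCell x)
  toCell-inside (i , j) = toℕ<n i , toℕ<n j

  fromCell-toCell : ∀ x → fromCell (toCell x) ≡ x
  fromCell-toCell (i , j) =
    cong₂ _,_ (toℕ-injective (toℕ-mod (toℕ<n i))) (toℕ-injective (toℕ-mod (toℕ<n j)))

  toCell-fromCell : ∀ {x} → InGrid m n x → toCell (fromCell x) ≡ x
  toCell-fromCell (i<m , j<n) = cong₂ _,_ (toℕ-mod i<m) (toℕ-mod j<n)

  toCell-injective : ∀ {x y} → toCell x ≡ toCell y → x ≡ y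
  toCell-injective {x} {y} eq =
    trans (sym (fromCell-toCell x)) (trans (cong fromCell eq) (fromCell-toCell y))

  toCell-reflects : ∀ {x y} → GridAdj n (toCell x) (toCell y) → PmCn m n x y
  toCell-reflects = Sum.map (Product.map₁ toℕ-injective) (Product.map₂ toℕ-injective)

  fromCell-surjection : GraphSurjection (GridAdj n) (InGrid m n) (PmCn m n) U fromCell
  fromCell-surjection = record
    { maps-to    = λ _ → tt
    ; preserves  = λ x∈ y∈ → toCell-reflects ∘
                     subst₂ (GridAdj n) (sym (toCell-fromCell x∈)) (sym (toCell-fromCell y∈))
    ; surjective = λ {y} _ → toCell y , toCell-inside y , fromCell-toCell y
    }

  cells : List (Fin m × Fin n)
  cells = cartesianProduct (allFin m) (allFin n)

  cells-unique : Unique cells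
  cells-unique = cartesianProduct⁺ (allFin⁺ m) (allFin⁺ n)

  length-cells : length cells ≡ m * n
  length-cells = trans (length-cartesianProduct (allFin m) (allFin n))
    (cong₂ _*_ (length-tabulate {n = m} id) (length-tabulate {n = n} id))

PmCn-2-spanningCyclable : ∀ m n → 2 ≤ m → 4 ≤ n → SpanningCyclable (Fin m × Fin n) (PmCn m n) 2
PmCn-2-spanningCyclable m n (s≤s (s≤s _)) (s≤s (s≤s (s≤s (s≤s {n = n′} _))))
                        (a ∷ b ∷ []) ((a≢b ∷ []) ∷ _) refl =
  SeparatingTours⇒Separates (cells-unique m n) (≤-reflexive (sym (length-cells m n)))
    (subst₂ (SeparatingTours (PmCn m n) U (m * n)) (fromCell-toCell m n a) (fromCell-toCell m n b)
      (SeparatingTours-map (fromCell-surjection m n)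
        (gridSeparation n′ (s≤s (s≤s z≤n)) (toCell-inside m n a) (toCell-inside m n b)
                        (a≢b ∘ toCell-injective m n))))

theorem3p4 : (m n : ℕ) → 3 ≤ m → 4 ≤ n →
    SpanningCyclable (Fin m × Fin n) (PmCn m n) 2
theorem3p4 m n 3≤m = PmCn-2-spanningCyclable m n (≤-trans (n≤1+n 2) 3≤m)
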